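{- Let $L$ be a spatial lattice with at least two elements and $\mathfrak{X}$ a relational structure of type $\tau$. Then $L^{\mathfrak{X}}$ and $\mathfrak{X}^+$ satisfy exactly the same equations built from variables using $\wedge,\vee,0,1$ and the operation symbols $f_i$ $(i\in I)$.
   Context: A spatial lattice is a bounded lattice isomorphic to the lattice of open sets of a topological space. A type is $\tau:I\to\mathbb{N}$, $n_i=\tau(i)$; $\mathfrak{X}=(X,(R_i)_{i\in I})$ with $R_i\subseteq X^{n_i+1}$. $L^{\mathfrak{X}}$ is $L^X$ with pointwise $\wedge,\vee,0,1$ and $f_i(\alpha_1,\ldots,\alpha_{n_i})(x)=\bigvee\{\alpha_1(x_1)\wedge\cdots\wedge\alpha_{n_i}(x_{n_i}):(x_1,\ldots,x_{n_i},x)\in R_i\}$. The complex algebra $\mathfrak{X}^+$ is $\mathcal{P}(X)$ with $\cap,\cup,\emptyset,X$ and $f_i(A_1,\ldots,A_{n_i})=\{x:\exists x_1\in A_1,\ldots,x_{n_i}\in A_{n_i}\ (x_1,\ldots,x_{n_i},x)\in R_i\}$. -}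

module Defs where

open import Level using (0ℓ) renaming (suc to lsuc)
open import Data.Nat using (ℕ; zero; suc)
open import Data.Fin using (Fin; zero; suc)
open import Data.Product using (Σ; Σ-syntax; ∃; ∃-syntax; _×_; _,_; proj₁; proj₂)
open import Data.Sum using (_⊎_)
open import Data.Unit using (⊤)
open import Data.Empty using (⊥)
open import Function using (_∘_)
open import Relation.Nullary using (¬_)
open import Relation.Binary.Lattice.Bundles using (BoundedLattice)

_⊆_ : {P : Set} → (P → Set) → (P → Set) → Set
U ⊆ V = ∀ x → U x → V x

_≐_ : {P : Set} → (P → Set) → (P → Set) → Set
U ≐ V = U ⊆ V × V ⊆ U

record TopSpace : Set₁ where
  field
    Point    : Set
    IsOpen   : (Point → Set) → Set
    open-ext : ∀ {U V} → U ≐ V → IsOpen U → IsOpen V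
    open-∅   : IsOpen (λ _ → ⊥)
    open-X   : IsOpen (λ _ → ⊤)
    open-∩   : ∀ {U V} → IsOpen U → IsOpen V → IsOpen (λ x → U x × V x)
    open-⋃   : (J : Set) (U : J → Point → Set) → (∀ j → IsOpen (U j))
             → IsOpen (λ x → Σ[ j ∈ J ] U j x)

-- An order isomorphism between
-- lattices is the same as a lattice isomorphism.

record SpatialLattice : Set₂ where
  field
    L     : BoundedLattice 0ℓ 0ℓ 0ℓ
    space : TopSpace
  open BoundedLattice L
  open TopSpace space
  field
    φ          : Carrier → Point → Set
    φ-open     : ∀ a → IsOpen (φ a)
    φ-mono     : ∀ {a b} → a ≤ b → φ a ⊆ φ b
    φ-reflect  : ∀ {a b} → φ a ⊆ φ b → a ≤ b
    φ-onto     : ∀ U → IsOpen U → Σ[ a ∈ Carrier ] (φ a ≐ U)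

  -- The (complete) join in L of an arbitrary family, transported along
  -- the isomorphism from unions of open sets.
  ⋁ : {J : Set} → (J → Carrier) → Carrier
  ⋁ {J} S = proj₁ (φ-onto (λ y → Σ[ j ∈ J ] φ (S j) y)
                          (open-⋃ J (φ ∘ S) (φ-open ∘ S)))

record Type : Set₁ where
  field
    I  : Set
    ar : I → ℕ

-- A relational structure of type τ: R_i ⊆ X^{n_i + 1}; a tuple
-- (x_1,…,x_{n_i},x) is given as (xs , x) with xs : Fin n_i → X.
record RelStructure (τ : Type) : Set₁ where
  open Type τ
  field
    X : Set
    R : (i : I) → (Fin (ar i) → X) → X → Set

record Alg (τ : Type) (a ℓ : Level.Level) : Set (lsuc (a Level.⊔ ℓ)) where
  open Type τ
  field
    Carrier : Set a
    _≈_     : Carrier → Carrier → Set ℓ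
    _⊓_     : Carrier → Carrier → Carrier
    _⊔_     : Carrier → Carrier → Carrier
    𝟘       : Carrier
    𝟙       : Carrier
    op      : (i : I) → (Fin (ar i) → Carrier) → Carrier

data Term (τ : Type) : Set where
  var  : ℕ → Term τ
  _∧ₜ_ : Term τ → Term τ → Term τ
  _∨ₜ_ : Term τ → Term τ → Term τ
  0ₜ   : Term τ
  1ₜ   : Term τ
  fₜ   : (i : Type.I τ) → (Fin (Type.ar τ i) → Term τ) → Term τ

module _ {τ : Type} {a ℓ} (A : Alg τ a ℓ) where
  open Alg A

  ⟦_⟧ : Term τ → (ℕ → Carrier) → Carrier
  ⟦ var n ⟧   ρ = ρ n
  ⟦ s ∧ₜ t ⟧  ρ = ⟦ s ⟧ ρ ⊓ ⟦ t ⟧ ρ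
  ⟦ s ∨ₜ t ⟧  ρ = ⟦ s ⟧ ρ ⊔ ⟦ t ⟧ ρ
  ⟦ 0ₜ ⟧      ρ = 𝟘
  ⟦ 1ₜ ⟧      ρ = 𝟙
  ⟦ fₜ i ts ⟧ ρ = op i (λ k → ⟦ ts k ⟧ ρ)

  Satisfies : Term τ → Term τ → Set (a Level.⊔ ℓ)
  Satisfies s t = ∀ (ρ : ℕ → Carrier) → ⟦ s ⟧ ρ ≈ ⟦ t ⟧ ρ

module _ (SL : SpatialLattice) where
  open SpatialLattice SL
  open BoundedLattice L using (Carrier; _≈_; _∧_; _∨_) renaming (⊤ to top; ⊥ to bot)

  ⋀ : (n : ℕ) → (Fin n → Carrier) → Carrier
  ⋀ zero    α = top
  ⋀ (suc n) α = α zero ∧ ⋀ n (α ∘ suc)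

  _^_ : {τ : Type} → RelStructure τ → Alg τ 0ℓ 0ℓ
  _^_ {τ} 𝔛 = record
    { Carrier = X → Carrier
    ; _≈_     = λ α β → ∀ x → α x ≈ β x
    ; _⊓_     = λ α β x → α x ∧ β x
    ; _⊔_     = λ α β x → α x ∨ β x
    ; 𝟘       = λ _ → bot
    ; 𝟙       = λ _ → top
    ; op      = λ i αs x →
        ⋁ {Σ[ xs ∈ (Fin (ar i) → X) ] R i xs x}
          (λ p → ⋀ (ar i) (λ k → αs k (proj₁ p k)))
    }
    where open Type τ
          open RelStructure 𝔛

_⁺ : {τ : Type} → RelStructure τ → Alg τ (lsuc 0ℓ) 0ℓ
_⁺ {τ} 𝔛 = record
  { Carrier = X → Set
  ; _≈_     = _≐_
  ; _⊓_     = λ A B x → A x × B x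
  ; _⊔_     = λ A B x → A x ⊎ B x
  ; 𝟘       = λ _ → ⊥
  ; 𝟙       = λ _ → ⊤
  ; op      = λ i As x →
      ∃[ xs ] ((∀ k → As k (xs k)) × R i xs x)
  }
  where open Type τ
        open RelStructure 𝔛

AtLeastTwo : SpatialLattice → Set
AtLeastTwo SL = ∃[ a ] ∃[ b ] ¬ (a ≈ b)
  where open BoundedLattice (SpatialLattice.L SL)

-- For a point y of the space, x ↦ [y ∈ φ(α x)] sends a valuation α in L^𝔛 to
-- one in 𝔛⁺ and commutes with every term, because φ turns finite meets and
-- arbitrary joins into intersections and unions.  Every valuation in 𝔛⁺ arises
-- this way (take α x = ⋁ of the constant family ⊤ indexed by the proposition
-- ρ x), so an equation of L^𝔛 holds in 𝔛⁺ as soon as the space has a point;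
-- classically it has one, since otherwise φ would identify all of L.
-- Conversely, the points separate the elements of L, so an equation of 𝔛⁺
-- transfers to L^𝔛 by testing it at every point.
module Submission where

open import Defs
open import Level using (0ℓ)
open import Axiom.ExcludedMiddle using (ExcludedMiddle)
open import Data.Product using (Σ-syntax; _×_; _,_; proj₁; proj₂)
open import Data.Sum using (_⊎_; inj₁; inj₂; [_,_])
open import Data.Bool using (Bool; true; false)
open import Data.Nat using (ℕ; zero; suc)
open import Data.Fin using (Fin; zero; suc)
open import Data.Unit using (tt)
open import Data.Empty using (⊥-elim)
open import Function using (_∘_; const)
open import Function.Bundles using (_⇔_; mk⇔; Equivalence)
open import Function.Construct.Composition using (_⇔-∘_)
open import Function.Construct.Identity using (⇔-id)
open import Data.Product.Function.NonDependent.Propositional using (_×-⇔_)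
open import Data.Sum.Function.Propositional using (_⊎-⇔_)
open import Relation.Nullary using (¬_; yes; no)
open import Relation.Binary.Lattice.Bundles using (BoundedLattice)

open Equivalence using (to; from)

module SpatialLatticeProperties (SL : SpatialLattice) where
  open SpatialLattice SL
  open BoundedLattice L
  open TopSpace space

  φ⁻¹ : (U : Point → Set) → IsOpen U → Carrier
  φ⁻¹ U U-open = proj₁ (φ-onto U U-open)

  φ-φ⁻¹ : ∀ {U} (U-open : IsOpen U) → φ (φ⁻¹ U U-open) ≐ U
  φ-φ⁻¹ {U} U-open = proj₂ (φ-onto U U-open)

  ≤φ⁻¹ : ∀ {a U} (U-open : IsOpen U) → φ a ⊆ U → a ≤ φ⁻¹ U U-open
  ≤φ⁻¹ U-open φa⊆U = φ-reflect (λ y → proj₂ (φ-φ⁻¹ U-open) y ∘ φa⊆U y)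

  φ⁻¹≤ : ∀ {a U} (U-open : IsOpen U) → U ⊆ φ a → φ⁻¹ U U-open ≤ a
  φ⁻¹≤ U-open U⊆φa = φ-reflect (λ y → U⊆φa y ∘ proj₁ (φ-φ⁻¹ U-open) y)

  φ-injective : ∀ {a b} → φ a ≐ φ b → a ≈ b
  φ-injective (φa⊆φb , φb⊆φa) = antisym (φ-reflect φa⊆φb) (φ-reflect φb⊆φa)

  φ-cong : ∀ {a b} → a ≈ b → φ a ⊆ φ b
  φ-cong = φ-mono ∘ reflexive

  φ-⊤ : ∀ y → φ ⊤ y
  φ-⊤ y = φ-mono (maximum _) y (proj₂ (φ-φ⁻¹ open-X) y tt)

  φ-⊥ : ∀ y → ¬ φ ⊥ y
  φ-⊥ y = proj₁ (φ-φ⁻¹ open-∅) y ∘ φ-mono (minimum _) y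

  φ-∧ : ∀ a b y → φ (a ∧ b) y ⇔ (φ a y × φ b y)
  φ-∧ a b y = mk⇔
    (λ p → φ-mono (x∧y≤x a b) y p , φ-mono (x∧y≤y a b) y p)
    (λ p → φ-mono (∧-greatest (φ⁻¹≤ ∩-open (λ _ → proj₁)) (φ⁻¹≤ ∩-open (λ _ → proj₂))) y
             (proj₂ (φ-φ⁻¹ ∩-open) y p))
    where ∩-open = open-∩ (φ-open a) (φ-open b)

  ∪-open : ∀ {U V} → IsOpen U → IsOpen V → IsOpen (λ y → U y ⊎ V y)
  ∪-open {U} {V} U-open V-open =
    open-ext ((λ { y (true , p) → inj₁ p ; y (false , p) → inj₂ p })
             , λ { y (inj₁ p) → true , p ; y (inj₂ p) → false , p })
      (open-⋃ Bool (λ { true → U ; false → V })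
                   (λ { true → U-open ; false → V-open }))

  φ-∨ : ∀ a b y → φ (a ∨ b) y ⇔ (φ a y ⊎ φ b y)
  φ-∨ a b y = mk⇔
    (λ p → proj₁ (φ-φ⁻¹ ∪-φ-open) y
             (φ-mono (∨-least (≤φ⁻¹ ∪-φ-open (λ _ → inj₁)) (≤φ⁻¹ ∪-φ-open (λ _ → inj₂))) y p))
    [ φ-mono (x≤x∨y a b) y , φ-mono (y≤x∨y a b) y ]
    where ∪-φ-open = ∪-open (φ-open a) (φ-open b)

  φ-⋀ : ∀ n (α : Fin n → Carrier) y → φ (⋀ SL n α) y ⇔ (∀ k → φ (α k) y)
  φ-⋀ zero    α y = mk⇔ (λ _ ()) (λ _ → φ-⊤ y)
  φ-⋀ (suc n) α y = mk⇔
    (λ p → λ { zero    → proj₁ (to (φ-∧ _ _ y) p)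
             ; (suc k) → to (φ-⋀ n (α ∘ suc) y) (proj₂ (to (φ-∧ _ _ y) p)) k })
    (λ f → from (φ-∧ _ _ y) (f zero , from (φ-⋀ n (α ∘ suc) y) (f ∘ suc)))

  φ-⋁ : ∀ {J : Set} (α : J → Carrier) y → φ (⋁ α) y ⇔ (Σ[ j ∈ J ] φ (α j) y)
  φ-⋁ α y = mk⇔ (proj₁ (φ-φ⁻¹ ⋃-open) y) (proj₂ (φ-φ⁻¹ ⋃-open) y)
    where ⋃-open = open-⋃ _ (φ ∘ α) (φ-open ∘ α)

  χ : Set → Carrier
  χ P = ⋁ {P} (const ⊤)

  φ-χ : ∀ P y → φ (χ P) y ⇔ P
  φ-χ P y = mk⇔ (proj₁ ∘ to (φ-⋁ {P} (const ⊤) y)) (λ p → from (φ-⋁ {P} (const ⊤) y) (p , φ-⊤ y))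

  inhabited : ExcludedMiddle 0ℓ → AtLeastTwo SL → Point
  inhabited em (a , b , a≉b) with em {Point}
  ... | yes y  = y
  ... | no ¬y = ⊥-elim (a≉b (φ-injective ((λ y _ → ⊥-elim (¬y y)) , (λ y _ → ⊥-elim (¬y y)))))

  module _ {τ : Type} (𝔛 : RelStructure τ) where
    open Type τ
    open RelStructure 𝔛

    ⟦_⟧^ : Term τ → (ℕ → X → Carrier) → X → Carrier
    ⟦_⟧^ = ⟦ SL ^ 𝔛 ⟧

    ⟦_⟧⁺ : Term τ → (ℕ → X → Set) → X → Set
    ⟦_⟧⁺ = ⟦ 𝔛 ⁺ ⟧

    φ-⟦⟧ : ∀ y (α : ℕ → X → Carrier) (ρ : ℕ → X → Set)
         → (∀ n x → φ (α n x) y ⇔ ρ n x)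
         → ∀ t x → φ (⟦ t ⟧^ α x) y ⇔ ⟦ t ⟧⁺ ρ x
    φ-⟦⟧ y α ρ α⇔ρ = go
      where
        go : ∀ t x → φ (⟦ t ⟧^ α x) y ⇔ ⟦ t ⟧⁺ ρ x
        go (var n)    x = α⇔ρ n x
        go (s ∧ₜ t)   x = (go s x ×-⇔ go t x) ⇔-∘ φ-∧ _ _ y
        go (s ∨ₜ t)   x = (go s x ⊎-⇔ go t x) ⇔-∘ φ-∨ _ _ y
        go 0ₜ         x = mk⇔ (⊥-elim ∘ φ-⊥ y) λ ()
        go 1ₜ         x = mk⇔ (const tt) (const (φ-⊤ y))
        go (fₜ i ts)  x = mk⇔
          (λ p → let ((xs , r) , q) = to ⋁⇔ p
                 in xs , (λ k → to (go (ts k) (xs k)) (to (⋀⇔ xs) q k)) , r)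
          (λ { (xs , q , r) →
                 from ⋁⇔ ((xs , r) , from (⋀⇔ xs) (λ k → from (go (ts k) (xs k)) (q k))) })
          where
            args : (Fin (ar i) → X) → Fin (ar i) → Carrier
            args xs k = ⟦ ts k ⟧^ α (xs k)

            ⋁⇔ : φ (⟦ fₜ i ts ⟧^ α x) y
               ⇔ (Σ[ p ∈ Σ[ xs ∈ (Fin (ar i) → X) ] R i xs x ] φ (⋀ SL (ar i) (args (proj₁ p))) y)
            ⋁⇔ = φ-⋁ _ y

            ⋀⇔ : ∀ xs → φ (⋀ SL (ar i) (args xs)) y ⇔ (∀ k → φ (args xs k) y)
            ⋀⇔ xs = φ-⋀ (ar i) (args xs) y

    satisfies-^⇒⁺ : Point → ∀ s t → Satisfies (SL ^ 𝔛) s t → Satisfies (𝔛 ⁺) s t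
    satisfies-^⇒⁺ y s t sat ρ =
        (λ x → to (⟦ t ⟧χ x) ∘ φ-cong (sat α x) y ∘ from (⟦ s ⟧χ x))
      , (λ x → to (⟦ s ⟧χ x) ∘ φ-cong (Eq.sym (sat α x)) y ∘ from (⟦ t ⟧χ x))
      where
        α : ℕ → X → Carrier
        α n x = χ (ρ n x)
        ⟦_⟧χ : ∀ u x → φ (⟦ u ⟧^ α x) y ⇔ ⟦ u ⟧⁺ ρ x
        ⟦_⟧χ = φ-⟦⟧ y α ρ (λ n x → φ-χ (ρ n x) y)

    satisfies-⁺⇒^ : ∀ s t → Satisfies (𝔛 ⁺) s t → Satisfies (SL ^ 𝔛) s t
    satisfies-⁺⇒^ s t sat α x = φ-injective
        ((λ y → from (⟦ t ⟧at y) ∘ proj₁ (sat (at y)) x ∘ to (⟦ s ⟧at y))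
      , (λ y → from (⟦ s ⟧at y) ∘ proj₂ (sat (at y)) x ∘ to (⟦ t ⟧at y)))
      where
        at : Point → ℕ → X → Set
        at y n z = φ (α n z) y
        ⟦_⟧at : ∀ u y → φ (⟦ u ⟧^ α x) y ⇔ ⟦ u ⟧⁺ (at y) x
        ⟦ u ⟧at y = φ-⟦⟧ y α (at y) (λ n z → ⇔-id (at y n z)) u x

proposition4p3 : ExcludedMiddle 0ℓ → (SL : SpatialLattice) → AtLeastTwo SL
    → {τ : Type} (𝔛 : RelStructure τ) (s t : Term τ)
    → (Satisfies (SL ^ 𝔛) s t → Satisfies (𝔛 ⁺) s t)
      × (Satisfies (𝔛 ⁺) s t → Satisfies (SL ^ 𝔛) s t)
proposition4p3 em SL two 𝔛 s t =
  satisfies-^⇒⁺ 𝔛 (inhabited em two) s t , satisfies-⁺⇒^ 𝔛 s t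
  where open SpatialLatticeProperties SL
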